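{- Let $t,u$ be action-free CCS terms. If the equation $t\approx u$ is sound modulo rooted weak bisimilarity $\sim_{\mathtt{RWB}}$ over CCS, then it is also sound modulo strong bisimilarity $\sim_{\mathtt{B}}$ over $\mathrm{CCS}_{\mathcal{A}}$, i.e. $\sigma(t)\sim_{\mathtt{B}}\sigma(u)$ for every closed substitution $\sigma$ mapping variables to $\mathrm{CCS}_{\mathcal{A}}$ processes.
   Context: Let $\mathcal{A}$ be a nonempty set of action names, $\overline{\mathcal{A}}$ the co-names ($\overline{\overline{a}}=a\neq\overline{a}$), $\mathcal{A}_\tau=\mathcal{A}\cup\overline{\mathcal{A}}\cup\{\tau\}$. CCS terms: $t ::= \mathbf{0} \mid x \mid \mu.t \mid t+t \mid t\,\|\,t$, $x$ a variable, $\mu\in\mathcal{A}_\tau$. $\mathrm{CCS}_{\mathcal{A}}$ is the sublanguage whose prefixes use only actions from $\mathcal{A}$ (no co-names, no $\tau$). Transitions (also for open terms, where variables have no transitions): $\mu.t\xrightarrow{\mu}t$; if $t\xrightarrow{\mu}t'$ then $t+u\xrightarrow{\mu}t'$, $u+t\xrightarrow{\mu}t'$, $t\|u\xrightarrow{\mu}t'\|u$, $u\|t\xrightarrow{\mu}u\|t'$; if $t\xrightarrow{\alpha}t'$, $u\xrightarrow{\overline\alpha}u'$ ($\alpha\in\mathcal{A}\cup\overline{\mathcal{A}}$) then $t\|u\xrightarrow{\tau}t'\|u'$. A term $t$ is action-free if $t$ has no transition $t\xrightarrow{\mu}$ for any $\mu\in\mathcal{A}_\tau$ (equivalently, $t$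 contains no prefix operator). Strong bisimilarity $\sim_{\mathtt{B}}$ is the largest symmetric relation such that if $p\sim_{\mathtt{B}}q$ and $p\xrightarrow{\mu}p'$ then $q\xrightarrow{\mu}q'$ with $p'\sim_{\mathtt{B}}q'$. With $\xrightarrow{\varepsilon}$ the reflexive-transitive closure of $\xrightarrow{\tau}$, $p\xRightarrow{\mu}q$ means $p\xrightarrow{\varepsilon}\xrightarrow{\mu}\xrightarrow{\varepsilon}q$ for $\mu\ne\tau$ and $p\xrightarrow{\varepsilon}q$ for $\mu=\tau$, and $p\xRightarrow{\hat\mu}q$ means $p\xrightarrow{\varepsilon}\xrightarrow{\mu}\xrightarrow{\varepsilon}q$. Weak bisimilarity $\sim_{\mathtt{WB}}$: largest symmetric relation such that if $p\sim_{\mathtt{WB}}q$ and $p\xrightarrow{\mu}p'$ then either $\mu=\tau$ and $p'\sim_{\mathtt{WB}}q$, or $q\xRightarrow{\mu}q'$ with $p'\sim_{\mathtt{WB}}q'$. Rooted weak bisimilarity: $p\sim_{\mathtt{RWB}}q$ iff each $p\xrightarrow{\mu}p'$ is matched by $q\xRightarrow{\hat\mu}q'$ with $p'\sim_{\mathtt{WB}}q'$, and symmetrically. An equation $t\approx u$ is sound modulo a relation $\sim$ over a language if $\sigma(t)\sim\sigma(u)$ for all closed substitutions $\sigma$ into processes of that language. -}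

module Defs where

open import Data.Nat using (ℕ)
open import Data.Product using (Σ; _×_; ∃; _,_)
open import Data.Sum using (_⊎_)
open import Data.Empty using (⊥)
open import Relation.Nullary using (¬_)
open import Relation.Binary.PropositionalEquality using (_≡_)
open import Relation.Binary.Construct.Closure.ReflexiveTransitive using (Star)

-- The set 𝒜 of action names is a parameter A (nonemptiness is a separate
-- hypothesis in the statement).  Variables are natural numbers.
module CCS (A : Set) where

  data Act : Set where
    nm  : A → Act
    co  : A → Act
    τ   : Act

  Var : Set
  Var = ℕ

  infixl 6 _⊕_
  infixl 5 _∥_
  data Term : Set where
    𝟎    : Term
    var  : Var → Term
    _∙_  : Act → Term → Term
    _⊕_  : Term → Term → Term
    _∥_  : Term → Term → Term

  data Compl : Act → Act → Set where
    nm-co : ∀ a → Compl (nm a) (co a)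
    co-nm : ∀ a → Compl (co a) (nm a)

  -- SOS rules (also for open terms; variables have no transitions)
  data _—[_]→_ : Term → Act → Term → Set where
    pre   : ∀ μ t → (μ ∙ t) —[ μ ]→ t
    sumL  : ∀ {t t' μ} u → t —[ μ ]→ t' → (t ⊕ u) —[ μ ]→ t'
    sumR  : ∀ {t t' μ} u → t —[ μ ]→ t' → (u ⊕ t) —[ μ ]→ t'
    parL  : ∀ {t t' μ} u → t —[ μ ]→ t' → (t ∥ u) —[ μ ]→ (t' ∥ u)
    parR  : ∀ {t t' μ} u → t —[ μ ]→ t' → (u ∥ t) —[ μ ]→ (u ∥ t')
    sync  : ∀ {t t' u u' α β} → Compl α β →
            t —[ α ]→ t' → u —[ β ]→ u' → (t ∥ u) —[ τ ]→ (t' ∥ u')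

  data Closed : Term → Set where
    𝟎    : Closed 𝟎
    _∙_  : ∀ μ {t} → Closed t → Closed (μ ∙ t)
    _⊕_  : ∀ {t u} → Closed t → Closed u → Closed (t ⊕ u)
    _∥_  : ∀ {t u} → Closed t → Closed u → Closed (t ∥ u)

  data InCCS𝒜 : Term → Set where
    𝟎    : InCCS𝒜 𝟎
    var  : ∀ x → InCCS𝒜 (var x)
    _∙_  : ∀ a {t} → InCCS𝒜 t → InCCS𝒜 (nm a ∙ t)
    _⊕_  : ∀ {t u} → InCCS𝒜 t → InCCS𝒜 u → InCCS𝒜 (t ⊕ u)
    _∥_  : ∀ {t u} → InCCS𝒜 t → InCCS𝒜 u → InCCS𝒜 (t ∥ u)

  ActionFree : Term → Set
  ActionFree t = ∀ μ t' → ¬ (t —[ μ ]→ t')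

  _⟨_⟩ : Term → (Var → Term) → Term
  𝟎 ⟨ σ ⟩       = 𝟎
  var x ⟨ σ ⟩   = σ x
  (μ ∙ t) ⟨ σ ⟩ = μ ∙ (t ⟨ σ ⟩)
  (t ⊕ u) ⟨ σ ⟩ = (t ⟨ σ ⟩) ⊕ (u ⟨ σ ⟩)
  (t ∥ u) ⟨ σ ⟩ = (t ⟨ σ ⟩) ∥ (u ⟨ σ ⟩)

  Rel : Set₁
  Rel = Term → Term → Set

  Symmetric : Rel → Set
  Symmetric R = ∀ {p q} → R p q → R q p

  IsStrongBisim : Rel → Set
  IsStrongBisim R = ∀ {p q μ p'} → R p q → p —[ μ ]→ p' →
                    ∃ λ q' → (q —[ μ ]→ q') × R p' q'

  _∼B_ : Term → Term → Set₁
  p ∼B q = Σ Rel λ R → Symmetric R × IsStrongBisim R × R p q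

  _—ε→_ : Rel
  _—ε→_ = Star (λ p q → p —[ τ ]→ q)

  _=[_]⇒_ : Term → Act → Term → Set
  p =[ τ ]⇒ q    = p —ε→ q
  p =[ nm a ]⇒ q = ∃ λ p₁ → ∃ λ p₂ → p —ε→ p₁ × p₁ —[ nm a ]→ p₂ × p₂ —ε→ q
  p =[ co a ]⇒ q = ∃ λ p₁ → ∃ λ p₂ → p —ε→ p₁ × p₁ —[ co a ]→ p₂ × p₂ —ε→ q

  -- p ⟹^μ q  (always at least one μ-step, including μ = τ)
  _=[_]⇒̂_ : Term → Act → Term → Set
  p =[ μ ]⇒̂ q = ∃ λ p₁ → ∃ λ p₂ → p —ε→ p₁ × p₁ —[ μ ]→ p₂ × p₂ —ε→ q

  IsWeakBisim : Rel → Set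
  IsWeakBisim R = ∀ {p q μ p'} → R p q → p —[ μ ]→ p' →
                  (μ ≡ τ × R p' q) ⊎ (∃ λ q' → (q =[ μ ]⇒ q') × R p' q')

  _∼WB_ : Term → Term → Set₁
  p ∼WB q = Σ Rel λ R → Symmetric R × IsWeakBisim R × R p q

  _∼RWB_ : Term → Term → Set₁
  p ∼RWB q =
    (∀ {μ p'} → p —[ μ ]→ p' → ∃ λ q' → (q =[ μ ]⇒̂ q') × p' ∼WB q') ×
    (∀ {μ q'} → q —[ μ ]→ q' → ∃ λ p' → (p =[ μ ]⇒̂ p') × p' ∼WB q')

  ClosedSubst : (Var → Term) → Set
  ClosedSubst σ = ∀ x → Closed (σ x)

  ClosedSubst𝒜 : (Var → Term) → Set
  ClosedSubst𝒜 σ = ∀ x → Closed (σ x) × InCCS𝒜 (σ x)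

-- Processes of CCS_𝒜 can only perform actions a ∈ 𝒜, and never synchronise,
-- since two names are never complementary; so they have no τ-steps, every
-- weak transition between them is a single strong one, and (rooted) weak
-- bisimilarity restricted to them is strong bisimilarity.  An action-free
-- term is built from 𝟎 and variables only, so instantiating it with CCS_𝒜
-- processes stays inside CCS_𝒜, and the rooted weak bisimilarity granted by
-- soundness becomes strong bisimilarity.
module Submission where

open import Defs
open import Data.Nat using (ℕ)
open import Data.Product using (_×_; Σ; ∃; _,_; proj₁; proj₂)
open import Data.Sum using (_⊎_; inj₁; inj₂)
open import Data.Empty using (⊥-elim)
open import Relation.Nullary using (¬_)
open import Relation.Binary.PropositionalEquality using (_≡_; refl)
open import Relation.Binary.Construct.Closure.ReflexiveTransitive using (ε; _◅_)

module _ {A : Set} where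
  open CCS A

  bisimulation : ∀ {p q} → p ∼B q → Rel
  bisimulation (R , _) = R

  bisimulation-sym : ∀ {p q} (b : p ∼B q) → Symmetric (bisimulation b)
  bisimulation-sym (_ , sym , _) = sym

  bisimulation-isStrongBisim : ∀ {p q} (b : p ∼B q) → IsStrongBisim (bisimulation b)
  bisimulation-isStrongBisim (_ , _ , isBisim , _) = isBisim

  bisimulation-relates : ∀ {p q} (b : p ∼B q) → bisimulation b p q
  bisimulation-relates (_ , _ , _ , r) = r

  Transition : Term → Set
  Transition p = Σ Act λ μ → Σ Term λ p' → p —[ μ ]→ p'

  -- The bisimulation relating p and q is the pair (p, q), its mirror image,
  -- and the union of the bisimulations witnessing the matches; indexing that
  -- union by transitions keeps it a small relation.
  ∼B-by-matching : ∀ {p q} →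
    (∀ {μ p'} → p —[ μ ]→ p' → ∃ λ q' → (q —[ μ ]→ q') × p' ∼B q') →
    (∀ {μ q'} → q —[ μ ]→ q' → ∃ λ p' → (p —[ μ ]→ p') × p' ∼B q') →
    p ∼B q
  ∼B-by-matching {p} {q} match-p match-q = S , S-sym , S-isStrongBisim , inj₁ (inj₁ (refl , refl))
    where
    Index : Set
    Index = Transition p ⊎ Transition q

    witness : (i : Index) → Σ Term λ x → Σ Term λ y → x ∼B y
    witness (inj₁ (_ , _ , s)) = _ , _ , proj₂ (proj₂ (match-p s))
    witness (inj₂ (_ , _ , s)) = _ , _ , proj₂ (proj₂ (match-q s))

    R : Index → Rel
    R i = bisimulation (proj₂ (proj₂ (witness i)))

    S : Rel
    S x y = ((x ≡ p × y ≡ q) ⊎ (x ≡ q × y ≡ p)) ⊎ (Σ Index λ i → R i x y)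

    S-sym : Symmetric S
    S-sym (inj₁ (inj₁ (x≡p , y≡q))) = inj₁ (inj₂ (y≡q , x≡p))
    S-sym (inj₁ (inj₂ (x≡q , y≡p))) = inj₁ (inj₁ (y≡p , x≡q))
    S-sym (inj₂ (i , r)) = inj₂ (i , bisimulation-sym (proj₂ (proj₂ (witness i))) r)

    S-isStrongBisim : IsStrongBisim S
    S-isStrongBisim (inj₁ (inj₁ (refl , refl))) s =
      let q' , s' , b = match-p s in q' , s' , inj₂ (inj₁ (_ , _ , s) , bisimulation-relates b)
    S-isStrongBisim (inj₁ (inj₂ (refl , refl))) s =
      let p' , s' , b = match-q s in
      p' , s' , inj₂ (inj₂ (_ , _ , s) , bisimulation-sym b (bisimulation-relates b))
    S-isStrongBisim (inj₂ (i , r)) s with bisimulation-isStrongBisim (proj₂ (proj₂ (witness i))) r s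
    ... | y' , s' , r' = y' , s' , inj₂ (i , r')

  InCCS𝒜-step : ∀ {p μ p'} → InCCS𝒜 p → p —[ μ ]→ p' → InCCS𝒜 p'
  InCCS𝒜-step (_ ∙ h)   (pre _ _)       = h
  InCCS𝒜-step (h ⊕ _)   (sumL _ s)      = InCCS𝒜-step h s
  InCCS𝒜-step (_ ⊕ h)   (sumR _ s)      = InCCS𝒜-step h s
  InCCS𝒜-step (h ∥ h')  (parL _ s)      = InCCS𝒜-step h s ∥ h'
  InCCS𝒜-step (h ∥ h')  (parR _ s)      = h ∥ InCCS𝒜-step h' s
  InCCS𝒜-step (h ∥ h')  (sync _ s₁ s₂)  = InCCS𝒜-step h s₁ ∥ InCCS𝒜-step h' s₂

  InCCS𝒜-name : ∀ {p μ p'} → InCCS𝒜 p → p —[ μ ]→ p' → ∃ λ a → μ ≡ nm a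
  InCCS𝒜-name (a ∙ _)   (pre _ _)       = a , refl
  InCCS𝒜-name (h ⊕ _)   (sumL _ s)      = InCCS𝒜-name h s
  InCCS𝒜-name (_ ⊕ h)   (sumR _ s)      = InCCS𝒜-name h s
  InCCS𝒜-name (h ∥ _)   (parL _ s)      = InCCS𝒜-name h s
  InCCS𝒜-name (_ ∥ h)   (parR _ s)      = InCCS𝒜-name h s
  InCCS𝒜-name (h ∥ h')  (sync c s₁ s₂) with InCCS𝒜-name h s₁ | InCCS𝒜-name h' s₂ | c
  ... | _ , refl | _ , refl | ()

  InCCS𝒜-no-τ : ∀ {p p'} → InCCS𝒜 p → ¬ (p —[ τ ]→ p')
  InCCS𝒜-no-τ h s with InCCS𝒜-name h s
  ... | _ , ()

  InCCS𝒜-ε : ∀ {p q} → InCCS𝒜 p → p —ε→ q → p ≡ q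
  InCCS𝒜-ε _ ε       = refl
  InCCS𝒜-ε h (s ◅ _) = ⊥-elim (InCCS𝒜-no-τ h s)

  InCCS𝒜-⇒̂ : ∀ {p μ q} → InCCS𝒜 p → p =[ μ ]⇒̂ q → p —[ μ ]→ q
  InCCS𝒜-⇒̂ h (_ , _ , ε₁ , s , ε₂) with InCCS𝒜-ε h ε₁
  ... | refl with InCCS𝒜-ε (InCCS𝒜-step h s) ε₂
  ... | refl = s

  ∼WB⇒∼B : ∀ {p q} → InCCS𝒜 p → InCCS𝒜 q → p ∼WB q → p ∼B q
  ∼WB⇒∼B hp hq (R , R-sym , R-isWeakBisim , r) = R𝒜 , R𝒜-sym , R𝒜-isStrongBisim , hp , hq , r
    where
    R𝒜 : Rel
    R𝒜 x y = InCCS𝒜 x × InCCS𝒜 y × R x y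

    R𝒜-sym : Symmetric R𝒜
    R𝒜-sym (hx , hy , rxy) = hy , hx , R-sym rxy

    R𝒜-isStrongBisim : IsStrongBisim R𝒜
    R𝒜-isStrongBisim (hx , hy , rxy) s with InCCS𝒜-name hx s | R-isWeakBisim rxy s
    ... | _ , refl | inj₁ (() , _)
    ... | _ , refl | inj₂ (y' , y⇒y' , r') =
      let s' = InCCS𝒜-⇒̂ hy y⇒y' in y' , s' , InCCS𝒜-step hx s , InCCS𝒜-step hy s' , r'

  ∼RWB⇒∼B : ∀ {p q} → InCCS𝒜 p → InCCS𝒜 q → p ∼RWB q → p ∼B q
  ∼RWB⇒∼B {p} {q} hp hq (match-p , match-q) = ∼B-by-matching strong-p strong-q
    where
    strong-p : ∀ {μ p'} → p —[ μ ]→ p' → ∃ λ q' → (q —[ μ ]→ q') × p' ∼B q'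
    strong-p s with match-p s
    ... | q' , w , b = let s' = InCCS𝒜-⇒̂ hq w in
      q' , s' , ∼WB⇒∼B (InCCS𝒜-step hp s) (InCCS𝒜-step hq s') b

    strong-q : ∀ {μ q'} → q —[ μ ]→ q' → ∃ λ p' → (p —[ μ ]→ p') × p' ∼B q'
    strong-q s with match-q s
    ... | p' , w , b = let s' = InCCS𝒜-⇒̂ hp w in
      p' , s' , ∼WB⇒∼B (InCCS𝒜-step hp s') (InCCS𝒜-step hq s) b

  ActionFree-⟨⟩-InCCS𝒜 : ∀ t σ → ActionFree t → ClosedSubst𝒜 σ → InCCS𝒜 (t ⟨ σ ⟩)
  ActionFree-⟨⟩-InCCS𝒜 𝟎       _ _  _  = 𝟎
  ActionFree-⟨⟩-InCCS𝒜 (var x) _ _  cs = proj₂ (cs x)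
  ActionFree-⟨⟩-InCCS𝒜 (μ ∙ t) _ af _  = ⊥-elim (af μ t (pre μ t))
  ActionFree-⟨⟩-InCCS𝒜 (t ⊕ u) σ af cs =
    ActionFree-⟨⟩-InCCS𝒜 t σ (λ μ t' s → af μ t' (sumL u s)) cs ⊕
    ActionFree-⟨⟩-InCCS𝒜 u σ (λ μ u' s → af μ u' (sumR t s)) cs
  ActionFree-⟨⟩-InCCS𝒜 (t ∥ u) σ af cs =
    ActionFree-⟨⟩-InCCS𝒜 t σ (λ μ t' s → af μ (t' ∥ u) (parL u s)) cs ∥
    ActionFree-⟨⟩-InCCS𝒜 u σ (λ μ u' s → af μ (t ∥ u') (parR t s)) cs

proposition2 : (A : Set) → A → let open CCS A in
    (t u : Term) → ActionFree t → ActionFree u →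
    ((σ : ℕ → Term) → ClosedSubst σ → (t ⟨ σ ⟩) ∼RWB (u ⟨ σ ⟩)) →
    (σ : ℕ → Term) → ClosedSubst𝒜 σ → (t ⟨ σ ⟩) ∼B (u ⟨ σ ⟩)
proposition2 A _ t u t-actionFree u-actionFree sound σ σ-closed𝒜 =
  ∼RWB⇒∼B (ActionFree-⟨⟩-InCCS𝒜 t σ t-actionFree σ-closed𝒜)
          (ActionFree-⟨⟩-InCCS𝒜 u σ u-actionFree σ-closed𝒜)
          (sound σ (λ x → proj₁ (σ-closed𝒜 x)))
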